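{- Let $(\mathcal{L}(P),\vdash)$ be a disjunctive sequent calculus. Then (1) the set $\mathrm{Tau}(P)$ of all tautologies is a logical state, but the set $\mathrm{Cont}(P)$ of all contradictions is not; (2) the union of a directed (under inclusion) family of logical states is a logical state.
   Context: A disjunctive basis is $(P,\mathcal{A}_P)$ with $P$ a set of atomic formulae and $\mathcal{A}_P$ a set of sequents $p_1,\dots,p_n\vdash\mathrm{F}$, $p_i\in P$. Formulae $\mathcal{L}(P)$ and valid sequents $\Gamma\vdash\varphi$ ($\Gamma$ finite) are generated by simultaneous transfinite induction: atoms, $\mathrm{T}$, $\mathrm{F}$ are formulae; $\phi\wedge\psi$; $\dot{\bigvee}_{i\in I}\phi_i$ whenever $\phi_i,\phi_j\vdash\mathrm{F}$ valid for all $i\ne j$. Valid sequents: members of $\mathcal{A}_P$; $\phi\vdash\phi$; $\Gamma\vdash\psi\Rightarrow\Gamma,\phi\vdash\psi$; $\Gamma\vdash\phi,\ \Delta,\phi\vdash\psi\Rightarrow\Gamma,\Delta\vdash\psi$; $\mathrm{F}\vdash\phi$; $\vdash\mathrm{T}$; $\Gamma,\phi,\psi\vdash\theta\Rightarrow\Gamma,\phi\wedge\psi\vdash\theta$; $\Gamma\vdash\phi,\ \Delta\vdash\psi\Rightarrow\Gamma,\Delta\vdash\phi\wedge\psi$; for families with $\phi_i,\phi_j\vdash\mathrm{F}$ ($i\neq j$): ($\Gamma,\phi_i\vdash\theta$ for all $i$) $\Rightarrow\Gamma,\dot{\bigvee}_i\phi_i\vdash\theta$, and $\Gamma\vdash\phi_{i_0}\Rightarrow\Gamma\vdash\dot{\bigvee}_i\phi_i$.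 $X[\vdash]=\{\varphi:\Gamma\vdash\varphi\text{ valid for some finite }\Gamma\subseteq X\}$. A formula $\varphi$ is a tautology if $\mathrm{T}\vdash\varphi$ is valid, a contradiction if $\varphi\vdash\mathrm{F}$ is valid, satisfiable if neither. Conjunction: satisfiable formula built from atoms by $\wedge$ only. Flat formula: satisfiable $\dot{\bigvee}_i\mu_i$, $\mu_i$ conjunctions, $\mu_i,\mu_j\vdash\mathrm{F}$ for $i\ne j$. A logical state is a nonempty proper subset $S\subseteq\mathcal{L}(P)$ with (S1) a flat formula $\dot{\bigvee}_i\mu_i\in S$ implies $\mu_{i_0}\in S$ for some $i_0$; (S2) $S[\vdash]\subseteq S$. -}

module Defs where

open import Level using (Level)
open import Data.List using (List; []; _∷_; _++_; map)
open import Data.List.NonEmpty using (List⁺; toList)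
open import Data.List.Relation.Unary.All using (All)
open import Data.Product using (Σ; ∃; _×_)
open import Data.Empty using (⊥)
open import Relation.Nullary using (¬_)
open import Relation.Binary.PropositionalEquality using (_≡_; _≢_)

-- A disjunctive basis (P , A_P): P a set of atoms, A_P a set of sequents
-- p₁,…,pₙ ⊢ F (n ≥ 1), given as a predicate on nonempty lists of atoms.
module Basis (P : Set) (Ax : List⁺ P → Set) where

  -- Formulae L(P) and valid sequents, by simultaneous (inductive-inductive)
  -- definition.  Contexts Γ are finite lists, read as finite sets (see rule `set`).
  data Form : Set₁
  data _⊢_ : List Form → Form → Set₁

  infix 4 _⊢_

  data Form where
    atom : P → Form
    T F  : Form
    _∧_  : Form → Form → Form
    ⋁    : (I : Set) (φ : I → Form) →
           (∀ i j → i ≢ j → (φ i ∷ φ j ∷ []) ⊢ F) → Form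

  data _⊢_ where
    ax      : ∀ ps → Ax ps → map atom (toList ps) ⊢ F
    idt     : ∀ φ → (φ ∷ []) ⊢ φ
    weak    : ∀ {Γ φ ψ} → Γ ⊢ ψ → (φ ∷ Γ) ⊢ ψ
    cut     : ∀ {Γ Δ φ ψ} → Γ ⊢ φ → (φ ∷ Δ) ⊢ ψ → (Γ ++ Δ) ⊢ ψ
    F⊢      : ∀ φ → (F ∷ []) ⊢ φ
    ⊢T      : [] ⊢ T
    ∧L      : ∀ {Γ φ ψ θ} → (φ ∷ ψ ∷ Γ) ⊢ θ → ((φ ∧ ψ) ∷ Γ) ⊢ θ
    ∧R      : ∀ {Γ Δ φ ψ} → Γ ⊢ φ → Δ ⊢ ψ → (Γ ++ Δ) ⊢ (φ ∧ ψ)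
    ⋁L      : ∀ {Γ θ} I φ d → (∀ i → (φ i ∷ Γ) ⊢ θ) → (⋁ I φ d ∷ Γ) ⊢ θ
    ⋁R      : ∀ {Γ} I φ d (i₀ : I) → Γ ⊢ φ i₀ → Γ ⊢ ⋁ I φ d
    -- contexts are finite sets: structural exchange and contraction
    -- (duplication is an instance of weak), so lists with the same members
    -- are interchangeable
    exch    : ∀ Γ {Δ φ ψ θ} → (Γ ++ φ ∷ ψ ∷ Δ) ⊢ θ → (Γ ++ ψ ∷ φ ∷ Δ) ⊢ θ
    contr   : ∀ {Γ φ θ} → (φ ∷ φ ∷ Γ) ⊢ θ → (φ ∷ Γ) ⊢ θ

  Subset : Set₂
  Subset = Form → Set₁

  _⊆_ : Subset → Subset → Set₁
  X ⊆ Y = ∀ φ → X φ → Y φ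

  closure : Subset → Subset
  closure X φ = Σ (List Form) λ Γ → All X Γ × (Γ ⊢ φ)

  Tautology Contradiction Satisfiable : Form → Set₁
  Tautology φ = (T ∷ []) ⊢ φ
  Contradiction φ = (φ ∷ []) ⊢ F
  Satisfiable φ = ¬ Tautology φ × ¬ Contradiction φ

  data Conj : Form → Set₁ where
    atom : ∀ p → Conj (atom p)
    _∧_  : ∀ {φ ψ} → Conj φ → Conj ψ → Conj (φ ∧ ψ)

  Conjunction : Form → Set₁
  Conjunction φ = Conj φ × Satisfiable φ

  Tau Cont : Subset
  Tau = Tautology
  Cont = Contradiction

  record IsLogicalState (S : Subset) : Set₂ where
    field
      nonempty : ∃ λ φ → S φ
      proper   : ∃ λ φ → ¬ S φ
      S1 : ∀ I μ d → (∀ i → Conjunction (μ i)) → Satisfiable (⋁ I μ d) →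
           S (⋁ I μ d) → ∃ λ i → S (μ i)
      S2 : closure S ⊆ S

  ⋃ : (K : Set₁) → (K → Subset) → Subset
  ⋃ K S φ = Σ K λ k → S k φ

  Directed : (K : Set₁) → (K → Subset) → Set₁
  Directed K S = K × (∀ a b → ∃ λ c → S a ⊆ S c × S b ⊆ S c)

module Submission where

open import Defs
open import Data.List.NonEmpty using (List⁺; _∷_)
open import Data.List using (List; []; _∷_; _++_)
open import Data.List.Relation.Unary.All using (All; []; _∷_) renaming (map to All-map)
open import Data.List.Relation.Unary.All.Properties using (++⁺; ++⁻)
open import Data.Product using (_×_; _,_; Σ; proj₁)
open import Data.Empty using (⊥; ⊥-elim)
open import Data.Unit using (⊤; tt)
open import Relation.Nullary using (¬_)

-- Every axiom has at least one atom on the left, so the valuation making all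
-- atoms false validates every sequent; hence T ⊢ F is not derivable.  This
-- gives Tau a non-member, and since F entails everything, no logical state
-- contains F, which rules out Cont.  Unions of directed families are states
-- because a finite context from the union already lies in one member.

module _ (P : Set) (Ax : List⁺ P → Set) where
  open Basis P Ax
  open IsLogicalState

  ⟦_⟧ : Form → Set
  ⟦ atom p ⟧    = ⊥
  ⟦ T ⟧         = ⊤
  ⟦ F ⟧         = ⊥
  ⟦ φ ∧ ψ ⟧     = ⟦ φ ⟧ × ⟦ ψ ⟧
  ⟦ ⋁ I φ _ ⟧   = Σ I λ i → ⟦ φ i ⟧

  All-exch : ∀ {Q : Form → Set} Γ {Δ φ ψ} →
             All Q (Γ ++ ψ ∷ φ ∷ Δ) → All Q (Γ ++ φ ∷ ψ ∷ Δ)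
  All-exch Γ qs with ++⁻ Γ qs
  ... | qΓ , qψ ∷ qφ ∷ qΔ = ++⁺ qΓ (qφ ∷ qψ ∷ qΔ)

  sound : ∀ {Γ φ} → Γ ⊢ φ → All ⟦_⟧ Γ → ⟦ φ ⟧
  sound (ax (_ ∷ _) _) (() ∷ _)
  sound (idt _) (v ∷ []) = v
  sound (weak d) (_ ∷ vs) = sound d vs
  sound (cut {Γ} d e) vs with ++⁻ Γ vs
  ... | vΓ , vΔ = sound e (sound d vΓ ∷ vΔ)
  sound (F⊢ _) (() ∷ _)
  sound ⊢T _ = tt
  sound (∧L d) ((v , w) ∷ vs) = sound d (v ∷ w ∷ vs)
  sound (∧R {Γ} d e) vs with ++⁻ Γ vs
  ... | vΓ , vΔ = sound d vΓ , sound e vΔ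
  sound (⋁L _ _ _ ds) ((i , v) ∷ vs) = sound (ds i) (v ∷ vs)
  sound (⋁R _ _ _ i d) vs = i , sound d vs
  sound (exch Γ d) vs = sound d (All-exch Γ vs)
  sound (contr d) (v ∷ vs) = sound d (v ∷ v ∷ vs)

  T⊬F : ¬ ((T ∷ []) ⊢ F)
  T⊬F d = sound d (tt ∷ [])

  discharge-tautologies : ∀ {Γ φ} → All Tautology Γ → Γ ⊢ φ → [] ⊢ φ
  discharge-tautologies []       d = d
  discharge-tautologies (t ∷ ts) d = discharge-tautologies ts (cut (cut ⊢T t) d)

  Tau-isLogicalState : IsLogicalState Tau
  Tau-isLogicalState = record
    { nonempty = T , idt T
    ; proper   = F , T⊬F
    ; S1       = λ _ _ _ _ satisfiable tautology → ⊥-elim (proj₁ satisfiable tautology)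
    ; S2       = λ _ (_ , ts , d) → weak (discharge-tautologies ts d)
    }

  F∉-logicalState : ∀ {S} → IsLogicalState S → ¬ S F
  F∉-logicalState ls F∈S with proper ls
  ... | φ , φ∉S = φ∉S (S2 ls φ (F ∷ [] , F∈S ∷ [] , F⊢ φ))

  Cont-notLogicalState : ¬ IsLogicalState Cont
  Cont-notLogicalState ls = F∉-logicalState ls (F⊢ F)

  directed-All-⋃ : ∀ {K S} → Directed K S → ∀ {Γ} →
                   All (⋃ K S) Γ → Σ K λ k → All (S k) Γ
  directed-All-⋃ (k , _) [] = k , []
  directed-All-⋃ dir@(_ , ub) ((k , φ∈Sk) ∷ rest) with directed-All-⋃ dir rest
  ... | l , Γ⊆Sl with ub k l
  ...   | m , Sk⊆Sm , Sl⊆Sm = m , Sk⊆Sm _ φ∈Sk ∷ All-map (Sl⊆Sm _) Γ⊆Sl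

  ⋃-isLogicalState : ∀ K S → (∀ k → IsLogicalState (S k)) →
                     Directed K S → IsLogicalState (⋃ K S)
  ⋃-isLogicalState K S ls dir@(k₀ , _) = record
    { nonempty = let (φ , φ∈S) = nonempty (ls k₀) in φ , k₀ , φ∈S
    ; proper   = F , λ (k , F∈Sk) → F∉-logicalState (ls k) F∈Sk
    ; S1       = λ I μ d conj sat (k , ⋁∈Sk) →
                   let (i , μi∈Sk) = S1 (ls k) I μ d conj sat ⋁∈Sk in i , k , μi∈Sk
    ; S2       = λ φ (Γ , Γ⊆⋃ , d) →
                   let (k , Γ⊆Sk) = directed-All-⋃ dir Γ⊆⋃ in k , S2 (ls k) φ (Γ , Γ⊆Sk , d)
    }

proposition3p3 : (P : Set) (Ax : List⁺ P → Set) →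
    let open Basis P Ax in
      (IsLogicalState Tau × ¬ IsLogicalState Cont)
      × ((K : Set₁) (S : K → Subset) → (∀ k → IsLogicalState (S k)) →
         Directed K S → IsLogicalState (⋃ K S))
proposition3p3 P Ax =
  (Tau-isLogicalState P Ax , Cont-notLogicalState P Ax) , ⋃-isLogicalState P Ax
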